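{- Let $p\ge 1$ be an integer. Then \begin{align*} f_p(a,b) &= 1 + x(ab)^p f_p(a,b) + x(ab)^p\,\frac{yb/a}{1-yb/a}\big(f_p(a,b)-f_p(by,b)\big)\\ &\quad + x(ab)^p\,\frac{ya/b}{1-ya/b}\big(f_p(a,b)-f_p(a,ay)\big), \end{align*} and $g_p(a,b)=x^{ -1}(ab)^{ -p}\big(f_p(a,b)-1\big)$.
   Context: A partially directed walk is a sequence of lattice points $v_0=(0,0),v_1,\dots,v_n\in\mathbb{Z}^2$ with steps in $\{(1,0),(0,1),(0,-1)\}$ (east, north, south), no north step immediately followed by a south step or vice versa. $\mathcal{V}_p=\{(n,m)\in\mathbb{Z}^2: n\ge0,\ -pn\le m\le pn\}$; a walk lies in $\mathcal{V}_p$ if all its vertices do. To a walk $\omega$ in $\mathcal{V}_p$ with $e$ east steps, $v$ vertical (north or south) steps and last vertex $(n,m)$ assign the weight $x^{e}y^{v}a^{m+pn}b^{pn-m}$ (so $a$ and $b$ record the vertical distances of the endpoint from the lines $Y=-pX$ and $Y=pX$). $g_p(a,b)=g_p(a,b;x,y)$ is the sum of the weights of all partially directed walks in $\mathcal{V}_p$, and $f_p(a,b)=f_p(a,b;x,y)$ is the sum of the weights of those walks in $\mathcal{V}_p$ that either have length $0$ or end with an east step. These are formal power series in $x,y$ with polynomial coefficients in $a,b$; $f_p(by,b)$ and $f_p(a,ay)$ denote the substitutions $a\mapsto by$ and $b\mapsto ay$, and the identity holds as formal power series in $x,y$ with coefficients rational in $a,b$. -}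

module Defs where

open import Data.Nat as ℕ using (ℕ; zero; suc)
open import Data.Integer as ℤ using (ℤ; +_; -_; _+_; _-_; _*_; _≤ᵇ_)
import Data.Integer.Properties as ℤP
import Data.Nat.Properties as ℕP
open import Data.Bool using (Bool; true; false; _∧_; if_then_else_)
open import Data.List using (List; []; _∷_; concatMap)
open import Data.Product using (_×_; _,_)
open import Relation.Nullary.Decidable using (⌊_⌋)

-- Partially directed walks, encoded as lists of steps (in order).

data Step : Set where
  E N S : Step

allSeqs : ℕ → List (List Step)
allSeqs zero    = [] ∷ []
allSeqs (suc n) = concatMap (λ w → (E ∷ w) ∷ (N ∷ w) ∷ (S ∷ w) ∷ []) (allSeqs n)

noReversal : List Step → Bool
noReversal (N ∷ S ∷ _) = false
noReversal (S ∷ N ∷ _) = false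
noReversal (_ ∷ w)     = noReversal w
noReversal []          = true

inV : ℕ → ℕ × ℤ → Bool
inV p (n , m) = (- (+ (p ℕ.* n)) ≤ᵇ m) ∧ (m ≤ᵇ + (p ℕ.* n))

allInV : ℕ → ℕ → ℤ → List Step → Bool
allInV p n m []      = inV p (n , m)
allInV p n m (E ∷ w) = inV p (n , m) ∧ allInV p (suc n) m w
allInV p n m (N ∷ w) = inV p (n , m) ∧ allInV p n (m + + 1) w
allInV p n m (S ∷ w) = inV p (n , m) ∧ allInV p n (m - + 1) w

endpoint : ℕ → ℤ → List Step → ℕ × ℤ
endpoint n m []      = (n , m)
endpoint n m (E ∷ w) = endpoint (suc n) m w
endpoint n m (N ∷ w) = endpoint n (m + + 1) w
endpoint n m (S ∷ w) = endpoint n (m - + 1) w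

numEast : List Step → ℕ
numEast []      = 0
numEast (E ∷ w) = suc (numEast w)
numEast (_ ∷ w) = numEast w

emptyOrEndsEast : List Step → Bool
emptyOrEndsEast []          = true
emptyOrEndsEast (E ∷ [])    = true
emptyOrEndsEast (_ ∷ [])    = false
emptyOrEndsEast (_ ∷ w@(_ ∷ _)) = emptyOrEndsEast w

-- the walk w has weight x^e y^v a^i b^j (given that it has length e+v)
hasWeight : ℕ → ℕ → ℤ → ℤ → List Step → Bool
hasWeight p e i j w with endpoint 0 (+ 0) w
... | (n , m) = ⌊ numEast w ℕ.≟ e ⌋ ∧ ⌊ i ℤ.≟ (m + + (p ℕ.* n)) ⌋
                ∧ ⌊ j ℤ.≟ (+ (p ℕ.* n) - m) ⌋

countBy : (List Step → Bool) → List (List Step) → ℕ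
countBy P []       = 0
countBy P (w ∷ ws) = if P w then suc (countBy P ws) else countBy P ws

-- Formal power series in x, y with coefficients Laurent polynomials in
-- a, b : a series is given by its coefficient function,
--   s e v i j = coefficient of x^e y^v a^i b^j.

Ser : Set
Ser = ℕ → ℕ → ℤ → ℤ → ℤ

gSer : ℕ → Ser
gSer p e v i j = + countBy
  (λ w → noReversal w ∧ allInV p 0 (+ 0) w ∧ hasWeight p e i j w)
  (allSeqs (e ℕ.+ v))

fSer : ℕ → Ser
fSer p e v i j = + countBy
  (λ w → noReversal w ∧ allInV p 0 (+ 0) w ∧ emptyOrEndsEast w
         ∧ hasWeight p e i j w)
  (allSeqs (e ℕ.+ v))

one : Ser
one zero zero (+ zero) (+ zero) = + 1
one _    _    _        _        = + 0

infixl 6 _⊕_ _⊖_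
_⊕_ : Ser → Ser → Ser
(s ⊕ t) e v i j = s e v i j + t e v i j

_⊖_ : Ser → Ser → Ser
(s ⊖ t) e v i j = s e v i j - t e v i j

xab^_·_ : ℕ → Ser → Ser
(xab^ p · s) zero    v i j = + 0
(xab^ p · s) (suc e) v i j = s e v (i - + p) (j - + p)

sumFrom : ℕ → ℕ → (ℕ → ℤ) → ℤ
sumFrom lo zero     h = if lo ℕ.≤ᵇ 0 then h 0 else + 0
sumFrom lo (suc hi) h = sumFrom lo hi h + (if lo ℕ.≤ᵇ suc hi then h (suc hi) else + 0)

-- multiplication by u/(1-u) = Σ_{k≥1} u^k , where u = y a^c b^d
-- (expanded as a power series in y)
geo : ℤ → ℤ → Ser → Ser
geo c d s e v i j = sumFrom 1 v (λ k → s e (v ℕ.∸ k) (i - + k * c) (j - + k * d))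

-- substitution a ↦ b y  (for series whose coefficients are polynomials in a, b)
substA : Ser → Ser
substA s e v (+ zero) j = sumFrom 0 v (λ t → s e (v ℕ.∸ t) (+ t) (j - + t))
substA s e v _        j = + 0

-- substitution b ↦ a y  (for series whose coefficients are polynomials in a, b)
substB : Ser → Ser
substB s e v i (+ zero) = sumFrom 0 v (λ t → s e (v ℕ.∸ t) (i - + t) (+ t))
substB s e v i _        = + 0

module Submission where

-- Classify the walks in V_p by their last step. Deleting the final east step
-- of a nonempty walk counted by f_p leaves an arbitrary walk counted by g_p and
-- divides the weight by x(ab)^p, since an east step never leaves V_p; this
-- gives the formula for g_p, and splitting g_p into the walks counted by f_p
-- and those ending with a north or a south step gives the functional equation
-- once the last two classes are identified. A north step multiplies the weight
-- by u = ya/b and keeps the walk in V_p exactly when the exponent of b stays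
-- non-negative, so the walks ending with a north step are counted by the part
-- of u/(1-u) f_p(a,b) with non-negative exponent of b. The remaining part is
-- u/(1-u) f_p(a,ay), because u^k a^i b^j with k > j equals u^(k-j) a^i (ay)^j.
-- Reflection in the X-axis exchanges north and south steps as well as a and b,
-- which gives the south term.

open import Defs
open import Data.Nat using (ℕ; _≤_; suc)
open import Data.Integer using (ℤ; +_; -_; _+_)
open import Data.Product using (_×_)
open import Relation.Binary.PropositionalEquality using (_≡_)

open import Data.Bool using (Bool; true; false; _∧_; not; if_then_else_; T)
open import Data.Bool.Properties using (T-∧; ∧-identityʳ; ∧-zeroʳ; ∧-comm; ∧-assoc)
open import Data.Empty using (⊥-elim)
open import Data.Integer using (-[1+_]; _-_; _*_; _≤ᵇ_)
import Data.Integer as ℤ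
import Data.Integer.Properties as ℤP
open import Data.Integer.Tactic.RingSolver using (solve-∀)
open import Data.List using (List; []; _∷_; _∷ʳ_; map; length; concatMap; initLast; _∷ʳ′_)
import Data.Nat as ℕ
open import Data.Nat using (zero)
import Data.Nat.Properties as ℕP
import Data.Nat.Tactic.RingSolver as ℕ-Solver
open import Data.Product using (_,_; proj₁; proj₂; map₂)
open import Data.Unit using (tt)
open import Function using (_∘_; _⇔_; mk⇔; Equivalence)
open import Relation.Binary.PropositionalEquality
  using (refl; sym; trans; cong; cong₂; subst; subst₂; module ≡-Reasoning)
open import Relation.Nullary using (¬_)
open import Relation.Nullary.Decidable using (Dec; ⌊_⌋; does-⇔; isYes≗does; toWitness)

open ≡-Reasoning

𝟙 : Bool → ℕ
𝟙 b = if b then 1 else 0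

𝟙-∧ : ∀ x y → 𝟙 (x ∧ y) ≡ 𝟙 x ℕ.* 𝟙 y
𝟙-∧ true  y = sym (ℕP.+-identityʳ (𝟙 y))
𝟙-∧ false y = refl

T-injective : ∀ {x y} → (T x → T y) → (T y → T x) → x ≡ y
T-injective {true}  {true}  _ _ = refl
T-injective {false} {false} _ _ = refl
T-injective {true}  {false} f _ = ⊥-elim (f tt)
T-injective {false} {true}  _ g = ⊥-elim (g tt)

¬T⇒≡false : ∀ {x} → ¬ T x → x ≡ false
¬T⇒≡false {true}  ¬x = ⊥-elim (¬x tt)
¬T⇒≡false {false} _  = refl

∧-shuffle : ∀ a s b h → (a ∧ s) ∧ (b ∧ h) ≡ a ∧ b ∧ s ∧ h
∧-shuffle false s     b h = refl
∧-shuffle true  true  b h = refl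
∧-shuffle true  false b h = sym (∧-zeroʳ b)

∧-absorbs : ∀ a x h → (T a → T h → T x) → (a ∧ x) ∧ h ≡ a ∧ h
∧-absorbs false x h _ = refl
∧-absorbs true  x false _ = ∧-zeroʳ x
∧-absorbs true  x true  f with x | f tt tt
... | true | _ = refl

⌊⌋-⇔ : ∀ {A B : Set} → A ⇔ B → (a? : Dec A) (b? : Dec B) → ⌊ a? ⌋ ≡ ⌊ b? ⌋
⌊⌋-⇔ A⇔B a? b? = trans (isYes≗does a?) (trans (does-⇔ A⇔B a? b?) (sym (isYes≗does b?)))

≟-shift : ∀ i a c → ⌊ i ℤ.≟ a + c ⌋ ≡ ⌊ i - c ℤ.≟ a ⌋
≟-shift i a c = ⌊⌋-⇔ (mk⇔ (λ i≡a+c → trans (cong (_- c) i≡a+c) (cancel a c))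
                          (λ i-c≡a → trans (sym (restore i c)) (cong (_+ c) i-c≡a)))
                     (i ℤ.≟ a + c) (i - c ℤ.≟ a)
  where
  cancel : ∀ a c → a + c - c ≡ a
  cancel = solve-∀
  restore : ∀ i c → i - c + c ≡ i
  restore = solve-∀

≟-suc : ∀ k e → ⌊ suc k ℕ.≟ suc e ⌋ ≡ ⌊ k ℕ.≟ e ⌋
≟-suc k e = ⌊⌋-⇔ (mk⇔ ℕP.suc-injective (cong suc)) (suc k ℕ.≟ suc e) (k ℕ.≟ e)

-- Counting words

count : (List Step → Bool) → ℕ → ℕ
count P n = countBy P (allSeqs n)

countBy-∷ : ∀ P w ws → countBy P (w ∷ ws) ≡ 𝟙 (P w) ℕ.+ countBy P ws
countBy-∷ P w ws with P w
... | true  = refl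
... | false = refl

count-∷ : ∀ P n → count P (suc n) ≡
  count (P ∘ (E ∷_)) n ℕ.+ count (P ∘ (N ∷_)) n ℕ.+ count (P ∘ (S ∷_)) n
count-∷ P n = go (allSeqs n)
  where
  extensions : List Step → List (List Step)
  extensions w = (E ∷ w) ∷ (N ∷ w) ∷ (S ∷ w) ∷ []

  go : ∀ ws → countBy P (concatMap extensions ws) ≡
    countBy (P ∘ (E ∷_)) ws ℕ.+ countBy (P ∘ (N ∷_)) ws ℕ.+ countBy (P ∘ (S ∷_)) ws
  go []       = refl
  go (w ∷ ws) = begin
    countBy P ((E ∷ w) ∷ (N ∷ w) ∷ (S ∷ w) ∷ concatMap extensions ws)
      ≡⟨ trans (countBy-∷ P (E ∷ w) ((N ∷ w) ∷ (S ∷ w) ∷ rest)) (cong (a ℕ.+_)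
           (trans (countBy-∷ P (N ∷ w) ((S ∷ w) ∷ rest)) (cong (b ℕ.+_) (countBy-∷ P (S ∷ w) rest)))) ⟩
    a ℕ.+ (b ℕ.+ (c ℕ.+ countBy P rest))
      ≡⟨ cong (λ r → a ℕ.+ (b ℕ.+ (c ℕ.+ r))) (go ws) ⟩
    a ℕ.+ (b ℕ.+ (c ℕ.+ (cE ℕ.+ cN ℕ.+ cS)))
      ≡⟨ regroup a b c cE cN cS ⟩
    (a ℕ.+ cE) ℕ.+ (b ℕ.+ cN) ℕ.+ (c ℕ.+ cS)
      ≡⟨ sym (cong₂ ℕ._+_ (cong₂ ℕ._+_ (countBy-∷ (P ∘ (E ∷_)) w ws) (countBy-∷ (P ∘ (N ∷_)) w ws))
                          (countBy-∷ (P ∘ (S ∷_)) w ws)) ⟩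
    countBy (P ∘ (E ∷_)) (w ∷ ws) ℕ.+ countBy (P ∘ (N ∷_)) (w ∷ ws) ℕ.+ countBy (P ∘ (S ∷_)) (w ∷ ws) ∎
    where
    rest : List (List Step)
    rest = concatMap extensions ws
    a b c cE cN cS : ℕ
    a = 𝟙 (P (E ∷ w))
    b = 𝟙 (P (N ∷ w))
    c = 𝟙 (P (S ∷ w))
    cE = countBy (P ∘ (E ∷_)) ws
    cN = countBy (P ∘ (N ∷_)) ws
    cS = countBy (P ∘ (S ∷_)) ws
    regroup : ∀ a b c x y z → a ℕ.+ (b ℕ.+ (c ℕ.+ (x ℕ.+ y ℕ.+ z))) ≡ (a ℕ.+ x) ℕ.+ (b ℕ.+ y) ℕ.+ (c ℕ.+ z)
    regroup = ℕ-Solver.solve-∀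

count-cong : ∀ n {P Q} → (∀ w → length w ≡ n → P w ≡ Q w) → count P n ≡ count Q n
count-cong zero    P≡Q = cong 𝟙 (P≡Q [] refl)
count-cong (suc n) {P} {Q} P≡Q = begin
  count P (suc n)
    ≡⟨ count-∷ P n ⟩
  count (P ∘ (E ∷_)) n ℕ.+ count (P ∘ (N ∷_)) n ℕ.+ count (P ∘ (S ∷_)) n
    ≡⟨ cong₂ ℕ._+_ (cong₂ ℕ._+_ (after E) (after N)) (after S) ⟩
  count (Q ∘ (E ∷_)) n ℕ.+ count (Q ∘ (N ∷_)) n ℕ.+ count (Q ∘ (S ∷_)) n
    ≡⟨ count-∷ Q n ⟨
  count Q (suc n) ∎
  where
  after : ∀ t → count (P ∘ (t ∷_)) n ≡ count (Q ∘ (t ∷_)) n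
  after t = count-cong n (λ w len → P≡Q (t ∷ w) (cong suc len))

count-none : ∀ n {P} → (∀ w → length w ≡ n → P w ≡ false) → count P n ≡ 0
count-none n P≡false = trans (count-cong n P≡false) (none (allSeqs n))
  where
  none : ∀ ws → countBy (λ _ → false) ws ≡ 0
  none []       = refl
  none (_ ∷ ws) = none ws

count-+ : ∀ n {P Q R} → (∀ w → 𝟙 (P w) ≡ 𝟙 (Q w) ℕ.+ 𝟙 (R w)) →
  count P n ≡ count Q n ℕ.+ count R n
count-+ n {P} {Q} {R} split = go (allSeqs n)
  where
  go : ∀ ws → countBy P ws ≡ countBy Q ws ℕ.+ countBy R ws
  go []       = refl
  go (w ∷ ws) = begin
    countBy P (w ∷ ws)                                     ≡⟨ countBy-∷ P w ws ⟩
    𝟙 (P w) ℕ.+ countBy P ws                               ≡⟨ cong₂ ℕ._+_ (split w) (go ws) ⟩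
    𝟙 (Q w) ℕ.+ 𝟙 (R w) ℕ.+ (countBy Q ws ℕ.+ countBy R ws) ≡⟨ interchange (𝟙 (Q w)) (𝟙 (R w)) (countBy Q ws) (countBy R ws) ⟩
    (𝟙 (Q w) ℕ.+ countBy Q ws) ℕ.+ (𝟙 (R w) ℕ.+ countBy R ws)
      ≡⟨ sym (cong₂ ℕ._+_ (countBy-∷ Q w ws) (countBy-∷ R w ws)) ⟩
    countBy Q (w ∷ ws) ℕ.+ countBy R (w ∷ ws) ∎
    where
    interchange : ∀ a b c d → a ℕ.+ b ℕ.+ (c ℕ.+ d) ≡ (a ℕ.+ c) ℕ.+ (b ℕ.+ d)
    interchange = ℕ-Solver.solve-∀

count-∷ʳ : ∀ P n → count P (suc n) ≡
  count (P ∘ (_∷ʳ E)) n ℕ.+ count (P ∘ (_∷ʳ N)) n ℕ.+ count (P ∘ (_∷ʳ S)) n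
count-∷ʳ P zero    = count-∷ P zero
count-∷ʳ P (suc n) = begin
  count P (suc (suc n))
    ≡⟨ count-∷ P (suc n) ⟩
  count (P ∘ (E ∷_)) (suc n) ℕ.+ count (P ∘ (N ∷_)) (suc n) ℕ.+ count (P ∘ (S ∷_)) (suc n)
    ≡⟨ cong₂ ℕ._+_ (cong₂ ℕ._+_ (count-∷ʳ (P ∘ (E ∷_)) n) (count-∷ʳ (P ∘ (N ∷_)) n))
                   (count-∷ʳ (P ∘ (S ∷_)) n) ⟩
  (c E E ℕ.+ c E N ℕ.+ c E S) ℕ.+ (c N E ℕ.+ c N N ℕ.+ c N S) ℕ.+ (c S E ℕ.+ c S N ℕ.+ c S S)
    ≡⟨ transpose (c E E) (c E N) (c E S) (c N E) (c N N) (c N S) (c S E) (c S N) (c S S) ⟩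
  (c E E ℕ.+ c N E ℕ.+ c S E) ℕ.+ (c E N ℕ.+ c N N ℕ.+ c S N) ℕ.+ (c E S ℕ.+ c N S ℕ.+ c S S)
    ≡⟨ sym (cong₂ ℕ._+_ (cong₂ ℕ._+_ (count-∷ (P ∘ (_∷ʳ E)) n) (count-∷ (P ∘ (_∷ʳ N)) n))
                        (count-∷ (P ∘ (_∷ʳ S)) n)) ⟩
  count (P ∘ (_∷ʳ E)) (suc n) ℕ.+ count (P ∘ (_∷ʳ N)) (suc n) ℕ.+ count (P ∘ (_∷ʳ S)) (suc n) ∎
  where
  c : Step → Step → ℕ
  c s t = count (λ w → P (s ∷ (w ∷ʳ t))) n
  transpose : ∀ a b c d e f g h i →
    (a ℕ.+ b ℕ.+ c) ℕ.+ (d ℕ.+ e ℕ.+ f) ℕ.+ (g ℕ.+ h ℕ.+ i) ≡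
    (a ℕ.+ d ℕ.+ g) ℕ.+ (b ℕ.+ e ℕ.+ h) ℕ.+ (c ℕ.+ f ℕ.+ i)
  transpose = ℕ-Solver.solve-∀

flipStep : Step → Step
flipStep E = E
flipStep N = S
flipStep S = N

count-flip : ∀ P n → count (P ∘ map flipStep) n ≡ count P n
count-flip P zero    = refl
count-flip P (suc n) = begin
  count (P ∘ map flipStep) (suc n)
    ≡⟨ count-∷ (P ∘ map flipStep) n ⟩
  count (P ∘ map flipStep ∘ (E ∷_)) n ℕ.+ count (P ∘ map flipStep ∘ (N ∷_)) n ℕ.+ count (P ∘ map flipStep ∘ (S ∷_)) n
    ≡⟨ cong₂ ℕ._+_ (cong₂ ℕ._+_ (count-flip (P ∘ (E ∷_)) n) (count-flip (P ∘ (S ∷_)) n))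
                   (count-flip (P ∘ (N ∷_)) n) ⟩
  count (P ∘ (E ∷_)) n ℕ.+ count (P ∘ (S ∷_)) n ℕ.+ count (P ∘ (N ∷_)) n
    ≡⟨ swap-last (count (P ∘ (E ∷_)) n) _ _ ⟩
  count (P ∘ (E ∷_)) n ℕ.+ count (P ∘ (N ∷_)) n ℕ.+ count (P ∘ (S ∷_)) n
    ≡⟨ count-∷ P n ⟨
  count P (suc n) ∎
  where
  swap-last : ∀ a b c → a ℕ.+ b ℕ.+ c ≡ a ℕ.+ c ℕ.+ b
  swap-last = ℕ-Solver.solve-∀

-- The last step of a walk

_==_ : Step → Step → Bool
E == E = true
N == N = true
S == S = true
_ == _ = false

endsWith : (Step → Bool) → List Step → Bool
endsWith P []                = false
endsWith P (x ∷ [])          = P x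
endsWith P (_ ∷ w@(_ ∷ _))   = endsWith P w

endsWith-∷ʳ : ∀ P w t → endsWith P (w ∷ʳ t) ≡ P t
endsWith-∷ʳ P []          t = refl
endsWith-∷ʳ P (_ ∷ [])    t = refl
endsWith-∷ʳ P (_ ∷ y ∷ w) t = endsWith-∷ʳ P (y ∷ w) t

endsWith-map : ∀ P f w → endsWith P (map f w) ≡ endsWith (P ∘ f) w
endsWith-map P f []          = refl
endsWith-map P f (_ ∷ [])    = refl
endsWith-map P f (_ ∷ y ∷ w) = endsWith-map P f (y ∷ w)

endsWith-cong : ∀ {P Q} → (∀ x → P x ≡ Q x) → ∀ w → endsWith P w ≡ endsWith Q w
endsWith-cong P≡Q []          = refl
endsWith-cong P≡Q (x ∷ [])    = P≡Q x
endsWith-cong P≡Q (_ ∷ y ∷ w) = endsWith-cong P≡Q (y ∷ w)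

endsWith-false : ∀ w → endsWith (λ _ → false) w ≡ false
endsWith-false []          = refl
endsWith-false (_ ∷ [])    = refl
endsWith-false (_ ∷ y ∷ w) = endsWith-false (y ∷ w)

isVertical : Step → Bool
isVertical E = false
isVertical _ = true

emptyOrEndsEast≡ : ∀ w → emptyOrEndsEast w ≡ not (endsWith isVertical w)
emptyOrEndsEast≡ []              = refl
emptyOrEndsEast≡ (E ∷ [])        = refl
emptyOrEndsEast≡ (N ∷ [])        = refl
emptyOrEndsEast≡ (S ∷ [])        = refl
emptyOrEndsEast≡ (E ∷ w@(_ ∷ _)) = emptyOrEndsEast≡ w
emptyOrEndsEast≡ (N ∷ w@(_ ∷ _)) = emptyOrEndsEast≡ w
emptyOrEndsEast≡ (S ∷ w@(_ ∷ _)) = emptyOrEndsEast≡ w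

emptyOrEndsEast-∷ʳ : ∀ w t → emptyOrEndsEast (w ∷ʳ t) ≡ not (isVertical t)
emptyOrEndsEast-∷ʳ w t = trans (emptyOrEndsEast≡ (w ∷ʳ t)) (cong not (endsWith-∷ʳ isVertical w t))

emptyOrEndsEast-flip : ∀ w → emptyOrEndsEast (map flipStep w) ≡ emptyOrEndsEast w
emptyOrEndsEast-flip w = begin
  emptyOrEndsEast (map flipStep w)                  ≡⟨ emptyOrEndsEast≡ (map flipStep w) ⟩
  not (endsWith isVertical (map flipStep w))        ≡⟨ cong not (endsWith-map isVertical flipStep w) ⟩
  not (endsWith (isVertical ∘ flipStep) w)          ≡⟨ cong not (endsWith-cong vertical-flip w) ⟩
  not (endsWith isVertical w)                       ≡⟨ emptyOrEndsEast≡ w ⟨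
  emptyOrEndsEast w                                 ∎
  where
  vertical-flip : ∀ x → isVertical (flipStep x) ≡ isVertical x
  vertical-flip E = refl
  vertical-flip N = refl
  vertical-flip S = refl

𝟙-not-endsSouth : ∀ w →
  𝟙 (not (endsWith (_== S) w)) ≡ 𝟙 (emptyOrEndsEast w) ℕ.+ 𝟙 (endsWith (_== N) w)
𝟙-not-endsSouth w with initLast w
... | []       = refl
... | u ∷ʳ′ t
  rewrite endsWith-∷ʳ (_== S) u t | emptyOrEndsEast-∷ʳ u t | endsWith-∷ʳ (_== N) u t
  with t
... | E = refl
... | N = refl
... | S = refl

clashes : Step → Step → Bool
clashes E _ = false
clashes N x = x == S
clashes S x = x == N

noReversal-∷∷ : ∀ x y w → noReversal (x ∷ y ∷ w) ≡ not (clashes y x) ∧ noReversal (y ∷ w)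
noReversal-∷∷ E E _ = refl
noReversal-∷∷ E N _ = refl
noReversal-∷∷ E S _ = refl
noReversal-∷∷ N E _ = refl
noReversal-∷∷ N N _ = refl
noReversal-∷∷ N S _ = refl
noReversal-∷∷ S E _ = refl
noReversal-∷∷ S N _ = refl
noReversal-∷∷ S S _ = refl

noReversal-[_] : ∀ x → noReversal (x ∷ []) ≡ true
noReversal-[ E ] = refl
noReversal-[ N ] = refl
noReversal-[ S ] = refl

noReversal-∷ʳ : ∀ w t → noReversal (w ∷ʳ t) ≡ noReversal w ∧ not (endsWith (clashes t) w)
noReversal-∷ʳ []       t = noReversal-[ t ]
noReversal-∷ʳ (x ∷ []) t = begin
  noReversal (x ∷ t ∷ [])               ≡⟨ noReversal-∷∷ x t [] ⟩
  not (clashes t x) ∧ noReversal (t ∷ []) ≡⟨ cong (not (clashes t x) ∧_) noReversal-[ t ] ⟩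
  not (clashes t x) ∧ true              ≡⟨ ∧-identityʳ _ ⟩
  not (clashes t x)                     ≡⟨ cong (_∧ not (clashes t x)) noReversal-[ x ] ⟨
  noReversal (x ∷ []) ∧ not (clashes t x) ∎
noReversal-∷ʳ (x ∷ y ∷ w) t = begin
  noReversal (x ∷ y ∷ w ∷ʳ t)
    ≡⟨ noReversal-∷∷ x y (w ∷ʳ t) ⟩
  not (clashes y x) ∧ noReversal (y ∷ w ∷ʳ t)
    ≡⟨ cong (not (clashes y x) ∧_) (noReversal-∷ʳ (y ∷ w) t) ⟩
  not (clashes y x) ∧ (noReversal (y ∷ w) ∧ not (endsWith (clashes t) (y ∷ w)))
    ≡⟨ ∧-assoc (not (clashes y x)) _ _ ⟨
  (not (clashes y x) ∧ noReversal (y ∷ w)) ∧ not (endsWith (clashes t) (y ∷ w))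
    ≡⟨ cong (_∧ not (endsWith (clashes t) (y ∷ w))) (noReversal-∷∷ x y w) ⟨
  noReversal (x ∷ y ∷ w) ∧ not (endsWith (clashes t) (x ∷ y ∷ w)) ∎

noReversal-flip : ∀ w → noReversal (map flipStep w) ≡ noReversal w
noReversal-flip []          = refl
noReversal-flip (E ∷ w)     = noReversal-flip w
noReversal-flip (N ∷ [])    = refl
noReversal-flip (N ∷ E ∷ w) = noReversal-flip (E ∷ w)
noReversal-flip (N ∷ N ∷ w) = noReversal-flip (N ∷ w)
noReversal-flip (N ∷ S ∷ w) = refl
noReversal-flip (S ∷ [])    = refl
noReversal-flip (S ∷ E ∷ w) = noReversal-flip (E ∷ w)
noReversal-flip (S ∷ N ∷ w) = refl
noReversal-flip (S ∷ S ∷ w) = noReversal-flip (S ∷ w)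

numEast-∷ʳE : ∀ w → numEast (w ∷ʳ E) ≡ suc (numEast w)
numEast-∷ʳE []      = refl
numEast-∷ʳE (E ∷ w) = cong suc (numEast-∷ʳE w)
numEast-∷ʳE (N ∷ w) = numEast-∷ʳE w
numEast-∷ʳE (S ∷ w) = numEast-∷ʳE w

numEast-∷ʳN : ∀ w → numEast (w ∷ʳ N) ≡ numEast w
numEast-∷ʳN []      = refl
numEast-∷ʳN (E ∷ w) = cong suc (numEast-∷ʳN w)
numEast-∷ʳN (N ∷ w) = numEast-∷ʳN w
numEast-∷ʳN (S ∷ w) = numEast-∷ʳN w

numEast-flip : ∀ w → numEast (map flipStep w) ≡ numEast w
numEast-flip []      = refl
numEast-flip (E ∷ w) = cong suc (numEast-flip w)
numEast-flip (N ∷ w) = numEast-flip w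
numEast-flip (S ∷ w) = numEast-flip w

numEast<length : ∀ w → T (endsWith (_== N) w) → numEast w ℕ.< length w
numEast<length (N ∷ [])        _ = ℕ.s≤s ℕ.z≤n
numEast<length (E ∷ [])        ()
numEast<length (S ∷ [])        ()
numEast<length (E ∷ w@(_ ∷ _)) n = ℕ.s≤s (numEast<length w n)
numEast<length (N ∷ w@(_ ∷ _)) n = ℕP.m≤n⇒m≤1+n (numEast<length w n)
numEast<length (S ∷ w@(_ ∷ _)) n = ℕP.m≤n⇒m≤1+n (numEast<length w n)

step : Step → ℕ × ℤ → ℕ × ℤ
step E (n , m) = (suc n , m)
step N (n , m) = (n , m + + 1)
step S (n , m) = (n , m - + 1)

endpoint-∷ʳ : ∀ n m w t → endpoint n m (w ∷ʳ t) ≡ step t (endpoint n m w)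
endpoint-∷ʳ n m []      E = refl
endpoint-∷ʳ n m []      N = refl
endpoint-∷ʳ n m []      S = refl
endpoint-∷ʳ n m (E ∷ w) t = endpoint-∷ʳ (suc n) m w t
endpoint-∷ʳ n m (N ∷ w) t = endpoint-∷ʳ n (m + + 1) w t
endpoint-∷ʳ n m (S ∷ w) t = endpoint-∷ʳ n (m - + 1) w t

-m-1≡-[m+1] : ∀ m → - m - + 1 ≡ - (m + + 1)
-m-1≡-[m+1] = solve-∀

-m+1≡-[m-1] : ∀ m → - m + + 1 ≡ - (m - + 1)
-m+1≡-[m-1] = solve-∀

endpoint-flip : ∀ n m w → endpoint n (- m) (map flipStep w) ≡ map₂ -_ (endpoint n m w)
endpoint-flip n m []      = refl
endpoint-flip n m (E ∷ w) = endpoint-flip (suc n) m w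
endpoint-flip n m (N ∷ w) = trans (cong (λ m′ → endpoint n m′ (map flipStep w)) (-m-1≡-[m+1] m))
                                  (endpoint-flip n (m + + 1) w)
endpoint-flip n m (S ∷ w) = trans (cong (λ m′ → endpoint n m′ (map flipStep w)) (-m+1≡-[m-1] m))
                                  (endpoint-flip n (m - + 1) w)

-- Finite sums and geometric factors

sumFrom-cong : ∀ lo hi {h h′ : ℕ → ℤ} → (∀ k → h k ≡ h′ k) → sumFrom lo hi h ≡ sumFrom lo hi h′
sumFrom-cong lo zero     h≡h′ = cong (λ x → if lo ℕ.≤ᵇ 0 then x else + 0) (h≡h′ 0)
sumFrom-cong lo (suc hi) h≡h′ =
  cong₂ _+_ (sumFrom-cong lo hi h≡h′) (cong (λ x → if lo ℕ.≤ᵇ suc hi then x else + 0) (h≡h′ (suc hi)))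

sumFrom-1-suc : ∀ hi h → sumFrom 1 (suc hi) h ≡ h 1 + sumFrom 1 hi (h ∘ suc)
sumFrom-1-suc zero     h = trans (ℤP.+-identityˡ (h 1)) (sym (ℤP.+-identityʳ (h 1)))
sumFrom-1-suc (suc hi) h = trans (cong (_+ h (suc (suc hi))) (sumFrom-1-suc hi h)) (ℤP.+-assoc (h 1) _ _)

sumFrom-0 : ∀ hi h → sumFrom 0 hi h ≡ h 0 + sumFrom 1 hi h
sumFrom-0 zero     h = sym (ℤP.+-identityʳ (h 0))
sumFrom-0 (suc hi) h = trans (cong (_+ h (suc hi)) (sumFrom-0 hi h)) (ℤP.+-assoc (h 0) _ _)

geo-suc : ∀ c d s e v i j → geo c d s e (suc v) i j ≡ s e v (i - c) (j - d) + geo c d s e v (i - c) (j - d)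
geo-suc c d s e v i j = trans (sumFrom-1-suc v _) (cong₂ _+_
  (cong₂ (s e v) (one-step i c) (one-step j d))
  (sumFrom-cong 1 v (λ k → cong₂ (s e (v ℕ.∸ k)) (further-step i c (+ k)) (further-step j d (+ k)))))
  where
  one-step : ∀ i c → i - + 1 * c ≡ i - c
  one-step = solve-∀
  further-step : ∀ i c k → i - (+ 1 + k) * c ≡ i - c - k * c
  further-step = solve-∀

geo-swap : ∀ c d s s′ → (∀ e v i j → s e v i j ≡ s′ e v j i) →
  ∀ e v i j → geo c d s e v i j ≡ geo d c s′ e v j i
geo-swap c d s s′ s≡s′ e v i j = sumFrom-cong 1 v (λ k → s≡s′ e (v ℕ.∸ k) _ _)

-- The cone V_p and the weights of walks

module _ (p : ℕ) where

  -- The vertical distances of a vertex from the lines Y = -pX and Y = pX, i.e.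
  -- the exponents of a and b; V_p is where both are non-negative.
  aDist bDist : ℕ × ℤ → ℤ
  aDist (n , m) = m + + (p ℕ.* n)
  bDist (n , m) = + (p ℕ.* n) - m

  aDist-E : ∀ q → aDist (step E q) ≡ aDist q + + p
  aDist-E (n , m) = trans (cong (λ k → m + + k) (ℕP.*-suc p n)) (rearrange m (+ p) (+ (p ℕ.* n)))
    where
    rearrange : ∀ m a b → m + (a + b) ≡ m + b + a
    rearrange = solve-∀

  bDist-E : ∀ q → bDist (step E q) ≡ bDist q + + p
  bDist-E (n , m) = trans (cong (λ k → + k - m) (ℕP.*-suc p n)) (rearrange m (+ p) (+ (p ℕ.* n)))
    where
    rearrange : ∀ m a b → (a + b) - m ≡ b - m + a
    rearrange = solve-∀

  aDist-N : ∀ q → aDist (step N q) ≡ aDist q + + 1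
  aDist-N (n , m) = rearrange m (+ (p ℕ.* n))
    where
    rearrange : ∀ m b → m + + 1 + b ≡ m + b + + 1
    rearrange = solve-∀

  bDist-N : ∀ q → bDist (step N q) ≡ bDist q - + 1
  bDist-N (n , m) = rearrange m (+ (p ℕ.* n))
    where
    rearrange : ∀ m b → b - (m + + 1) ≡ b - m - + 1
    rearrange = solve-∀

  aDist-flip : ∀ q → aDist (map₂ -_ q) ≡ bDist q
  aDist-flip (n , m) = ℤP.+-comm (- m) (+ (p ℕ.* n))

  bDist-flip : ∀ q → bDist (map₂ -_ q) ≡ aDist q
  bDist-flip (n , m) = trans (cong (λ x → + (p ℕ.* n) + x) (ℤP.neg-involutive m)) (ℤP.+-comm (+ (p ℕ.* n)) m)

  InV : ℕ × ℤ → Set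
  InV q = + 0 ℤ.≤ aDist q × + 0 ℤ.≤ bDist q

  inV⇒InV : ∀ q → T (inV p q) → InV q
  inV⇒InV (n , m) h = lower , upper
    where
    P : ℤ
    P = + (p ℕ.* n)
    bounds : T (- P ≤ᵇ m) × T (m ≤ᵇ P)
    bounds = Equivalence.to T-∧ h
    lower : + 0 ℤ.≤ m + P
    lower = subst (λ x → + 0 ℤ.≤ m + x) (ℤP.neg-involutive P)
                  (ℤP.i≤j⇒0≤j-i (ℤP.≤ᵇ⇒≤ { - P} {m} (proj₁ bounds)))
    upper : + 0 ℤ.≤ P - m
    upper = ℤP.i≤j⇒0≤j-i (ℤP.≤ᵇ⇒≤ {m} {P} (proj₂ bounds))

  InV⇒inV : ∀ q → InV q → T (inV p q)
  InV⇒inV (n , m) (lower , upper) = Equivalence.from T-∧ (ℤP.≤⇒≤ᵇ -P≤m , ℤP.≤⇒≤ᵇ m≤P)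
    where
    P : ℤ
    P = + (p ℕ.* n)
    -P≤m : - P ℤ.≤ m
    -P≤m = ℤP.0≤i-j⇒j≤i (subst (λ x → + 0 ℤ.≤ m + x) (sym (ℤP.neg-involutive P)) lower)
    m≤P : m ℤ.≤ P
    m≤P = ℤP.0≤i-j⇒j≤i upper

  InV-E : ∀ q → InV q → InV (step E q)
  InV-E q (a≥0 , b≥0) =
    subst (+ 0 ℤ.≤_) (sym (aDist-E q)) (ℤP.≤-trans a≥0 (ℤP.i≤i+j (aDist q) (+ p))) ,
    subst (+ 0 ℤ.≤_) (sym (bDist-E q)) (ℤP.≤-trans b≥0 (ℤP.i≤i+j (bDist q) (+ p)))

  InV-N : ∀ q → InV q → + 1 ℤ.≤ bDist q → InV (step N q)
  InV-N q (a≥0 , _) b≥1 =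
    subst (+ 0 ℤ.≤_) (sym (aDist-N q)) (ℤP.≤-trans a≥0 (ℤP.i≤i+j (aDist q) (+ 1))) ,
    subst (+ 0 ℤ.≤_) (sym (bDist-N q)) (ℤP.i≤j⇒0≤j-i b≥1)

  inV-flip : ∀ q → inV p (map₂ -_ q) ≡ inV p q
  inV-flip q = T-injective
    (λ h → let (a≥0 , b≥0) = inV⇒InV (map₂ -_ q) h in
           InV⇒inV q (subst (+ 0 ℤ.≤_) (bDist-flip q) b≥0 , subst (+ 0 ℤ.≤_) (aDist-flip q) a≥0))
    (λ h → let (a≥0 , b≥0) = inV⇒InV q h in
           InV⇒inV (map₂ -_ q) (subst (+ 0 ℤ.≤_) (sym (aDist-flip q)) b≥0 , subst (+ 0 ℤ.≤_) (sym (bDist-flip q)) a≥0))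

  allInV-∷ʳ : ∀ n m w t → allInV p n m (w ∷ʳ t) ≡ allInV p n m w ∧ inV p (step t (endpoint n m w))
  allInV-∷ʳ n m []      E = refl
  allInV-∷ʳ n m []      N = refl
  allInV-∷ʳ n m []      S = refl
  allInV-∷ʳ n m (E ∷ w) t = trans (cong (inV p (n , m) ∧_) (allInV-∷ʳ (suc n) m w t)) (sym (∧-assoc (inV p (n , m)) _ _))
  allInV-∷ʳ n m (N ∷ w) t = trans (cong (inV p (n , m) ∧_) (allInV-∷ʳ n (m + + 1) w t)) (sym (∧-assoc (inV p (n , m)) _ _))
  allInV-∷ʳ n m (S ∷ w) t = trans (cong (inV p (n , m) ∧_) (allInV-∷ʳ n (m - + 1) w t)) (sym (∧-assoc (inV p (n , m)) _ _))

  allInV⇒InV-endpoint : ∀ n m w → T (allInV p n m w) → InV (endpoint n m w)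
  allInV⇒InV-endpoint n m []      h = inV⇒InV (n , m) h
  allInV⇒InV-endpoint n m (E ∷ w) h = allInV⇒InV-endpoint (suc n) m w (proj₂ (Equivalence.to T-∧ h))
  allInV⇒InV-endpoint n m (N ∷ w) h = allInV⇒InV-endpoint n (m + + 1) w (proj₂ (Equivalence.to T-∧ h))
  allInV⇒InV-endpoint n m (S ∷ w) h = allInV⇒InV-endpoint n (m - + 1) w (proj₂ (Equivalence.to T-∧ h))

  allInV-flip : ∀ n m w → allInV p n (- m) (map flipStep w) ≡ allInV p n m w
  allInV-flip n m []      = inV-flip (n , m)
  allInV-flip n m (E ∷ w) = cong₂ _∧_ (inV-flip (n , m)) (allInV-flip (suc n) m w)
  allInV-flip n m (N ∷ w) = cong₂ _∧_ (inV-flip (n , m))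
    (trans (cong (λ m′ → allInV p n m′ (map flipStep w)) (-m-1≡-[m+1] m)) (allInV-flip n (m + + 1) w))
  allInV-flip n m (S ∷ w) = cong₂ _∧_ (inV-flip (n , m))
    (trans (cong (λ m′ → allInV p n m′ (map flipStep w)) (-m+1≡-[m-1] m)) (allInV-flip n (m - + 1) w))

  matches : ℕ → ℤ → ℤ → ℕ → ℕ × ℤ → Bool
  matches e i j k q = ⌊ k ℕ.≟ e ⌋ ∧ ⌊ i ℤ.≟ aDist q ⌋ ∧ ⌊ j ℤ.≟ bDist q ⌋

  hasWeight≡matches : ∀ e i j w → hasWeight p e i j w ≡ matches e i j (numEast w) (endpoint 0 (+ 0) w)
  hasWeight≡matches e i j w with endpoint 0 (+ 0) w
  ... | (n , m) = refl

  matches⇒ : ∀ e i j k q → T (matches e i j k q) → k ≡ e × i ≡ aDist q × j ≡ bDist q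
  matches⇒ e i j k q h =
    let (k≡e , i,j) = Equivalence.to (T-∧ {⌊ k ℕ.≟ e ⌋}) h
        (i≡a , j≡b) = Equivalence.to (T-∧ {⌊ i ℤ.≟ aDist q ⌋}) i,j
    in toWitness k≡e , toWitness i≡a , toWitness j≡b

  matches-E : ∀ e i j k q → matches (suc e) i j (suc k) (step E q) ≡ matches e (i - + p) (j - + p) k q
  matches-E e i j k q = cong₂ _∧_ (≟-suc k e) (cong₂ _∧_
    (trans (cong (λ a → ⌊ i ℤ.≟ a ⌋) (aDist-E q)) (≟-shift i (aDist q) (+ p)))
    (trans (cong (λ b → ⌊ j ℤ.≟ b ⌋) (bDist-E q)) (≟-shift j (bDist q) (+ p))))

  matches-N : ∀ e i j k q → matches e i j k (step N q) ≡ matches e (i - + 1) (j + + 1) k q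
  matches-N e i j k q = cong (⌊ k ℕ.≟ e ⌋ ∧_) (cong₂ _∧_
    (trans (cong (λ a → ⌊ i ℤ.≟ a ⌋) (aDist-N q)) (≟-shift i (aDist q) (+ 1)))
    (trans (cong (λ b → ⌊ j ℤ.≟ b ⌋) (bDist-N q)) (≟-shift j (bDist q) (- + 1))))

  matches-flip : ∀ e i j k q → matches e i j k (map₂ -_ q) ≡ matches e j i k q
  matches-flip e i j k q = cong (⌊ k ℕ.≟ e ⌋ ∧_) (trans
    (cong₂ _∧_ (cong (λ a → ⌊ i ℤ.≟ a ⌋) (aDist-flip q)) (cong (λ b → ⌊ j ℤ.≟ b ⌋) (bDist-flip q)))
    (∧-comm ⌊ i ℤ.≟ bDist q ⌋ _))

  hasWeight-∷ʳ : ∀ e i j w t →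
    hasWeight p e i j (w ∷ʳ t) ≡ matches e i j (numEast (w ∷ʳ t)) (step t (endpoint 0 (+ 0) w))
  hasWeight-∷ʳ e i j w t =
    trans (hasWeight≡matches e i j (w ∷ʳ t)) (cong (matches e i j (numEast (w ∷ʳ t))) (endpoint-∷ʳ 0 (+ 0) w t))

  hasWeight-∷ʳE : ∀ e i j w → hasWeight p (suc e) i j (w ∷ʳ E) ≡ hasWeight p e (i - + p) (j - + p) w
  hasWeight-∷ʳE e i j w = begin
    hasWeight p (suc e) i j (w ∷ʳ E)
      ≡⟨ hasWeight-∷ʳ (suc e) i j w E ⟩
    matches (suc e) i j (numEast (w ∷ʳ E)) (step E (endpoint 0 (+ 0) w))
      ≡⟨ cong (λ k → matches (suc e) i j k (step E (endpoint 0 (+ 0) w))) (numEast-∷ʳE w) ⟩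
    matches (suc e) i j (suc (numEast w)) (step E (endpoint 0 (+ 0) w))
      ≡⟨ matches-E e i j (numEast w) (endpoint 0 (+ 0) w) ⟩
    matches e (i - + p) (j - + p) (numEast w) (endpoint 0 (+ 0) w)
      ≡⟨ hasWeight≡matches e (i - + p) (j - + p) w ⟨
    hasWeight p e (i - + p) (j - + p) w ∎

  hasWeight-∷ʳN : ∀ e i j w → hasWeight p e i j (w ∷ʳ N) ≡ hasWeight p e (i - + 1) (j + + 1) w
  hasWeight-∷ʳN e i j w = begin
    hasWeight p e i j (w ∷ʳ N)
      ≡⟨ hasWeight-∷ʳ e i j w N ⟩
    matches e i j (numEast (w ∷ʳ N)) (step N (endpoint 0 (+ 0) w))
      ≡⟨ cong (λ k → matches e i j k (step N (endpoint 0 (+ 0) w))) (numEast-∷ʳN w) ⟩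
    matches e i j (numEast w) (step N (endpoint 0 (+ 0) w))
      ≡⟨ matches-N e i j (numEast w) (endpoint 0 (+ 0) w) ⟩
    matches e (i - + 1) (j + + 1) (numEast w) (endpoint 0 (+ 0) w)
      ≡⟨ hasWeight≡matches e (i - + 1) (j + + 1) w ⟨
    hasWeight p e (i - + 1) (j + + 1) w ∎

  hasWeight-flip : ∀ e i j w → hasWeight p e i j (map flipStep w) ≡ hasWeight p e j i w
  hasWeight-flip e i j w = begin
    hasWeight p e i j (map flipStep w)
      ≡⟨ hasWeight≡matches e i j (map flipStep w) ⟩
    matches e i j (numEast (map flipStep w)) (endpoint 0 (+ 0) (map flipStep w))
      ≡⟨ cong₂ (matches e i j) (numEast-flip w) (endpoint-flip 0 (+ 0) w) ⟩
    matches e i j (numEast w) (map₂ -_ (endpoint 0 (+ 0) w))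
      ≡⟨ matches-flip e i j (numEast w) (endpoint 0 (+ 0) w) ⟩
    matches e j i (numEast w) (endpoint 0 (+ 0) w)
      ≡⟨ hasWeight≡matches e j i w ⟨
    hasWeight p e j i w ∎

  hasWeight⇒ : ∀ e i j w → T (hasWeight p e i j w) →
    numEast w ≡ e × i ≡ aDist (endpoint 0 (+ 0) w) × j ≡ bDist (endpoint 0 (+ 0) w)
  hasWeight⇒ e i j w h =
    matches⇒ e i j (numEast w) (endpoint 0 (+ 0) w) (subst T (hasWeight≡matches e i j w) h)

  -- fSer p and gSer p are walkSeries emptyOrEndsEast and walkSeries (λ _ → true)
  -- up to definitional equality.
  walksWith : (List Step → Bool) → ℕ → ℤ → ℤ → List Step → Bool
  walksWith C e i j w = noReversal w ∧ allInV p 0 (+ 0) w ∧ C w ∧ hasWeight p e i j w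

  walkSeries : (List Step → Bool) → Ser
  walkSeries C e v i j = + count (walksWith C e i j) (e ℕ.+ v)

  northSeries southSeries : Ser
  northSeries = walkSeries (endsWith (_== N))
  southSeries = walkSeries (endsWith (_== S))

  walksWith⇒ : ∀ C e i j w → T (walksWith C e i j w) →
    T (C w) × InV (endpoint 0 (+ 0) w) × numEast w ≡ e × j ≡ bDist (endpoint 0 (+ 0) w)
  walksWith⇒ C e i j w h =
    let (_ , a,c,hw) = Equivalence.to (T-∧ {noReversal w}) h
        (a , c,hw)   = Equivalence.to (T-∧ {allInV p 0 (+ 0) w}) a,c,hw
        (c , hw)     = Equivalence.to (T-∧ {C w}) c,hw
        (k≡e , _ , j≡b) = hasWeight⇒ e i j w hw
    in c , allInV⇒InV-endpoint 0 (+ 0) w a , k≡e , j≡b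

  walksWith-split : ∀ C C₁ C₂ e i j w → 𝟙 (C w) ≡ 𝟙 (C₁ w) ℕ.+ 𝟙 (C₂ w) →
    𝟙 (walksWith C e i j w) ≡ 𝟙 (walksWith C₁ e i j w) ℕ.+ 𝟙 (walksWith C₂ e i j w)
  walksWith-split C C₁ C₂ e i j w split = begin
    𝟙 (walksWith C e i j w)          ≡⟨ factor C ⟩
    r ℕ.* (a ℕ.* (𝟙 (C w) ℕ.* h))   ≡⟨ cong (λ c → r ℕ.* (a ℕ.* (c ℕ.* h))) split ⟩
    r ℕ.* (a ℕ.* ((𝟙 (C₁ w) ℕ.+ 𝟙 (C₂ w)) ℕ.* h))
      ≡⟨ distrib r a (𝟙 (C₁ w)) (𝟙 (C₂ w)) h ⟩
    r ℕ.* (a ℕ.* (𝟙 (C₁ w) ℕ.* h)) ℕ.+ r ℕ.* (a ℕ.* (𝟙 (C₂ w) ℕ.* h))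
      ≡⟨ sym (cong₂ ℕ._+_ (factor C₁) (factor C₂)) ⟩
    𝟙 (walksWith C₁ e i j w) ℕ.+ 𝟙 (walksWith C₂ e i j w) ∎
    where
    r a h : ℕ
    r = 𝟙 (noReversal w)
    a = 𝟙 (allInV p 0 (+ 0) w)
    h = 𝟙 (hasWeight p e i j w)
    factor : ∀ C → 𝟙 (walksWith C e i j w) ≡ r ℕ.* (a ℕ.* (𝟙 (C w) ℕ.* h))
    factor C = trans (𝟙-∧ (noReversal w) _) (cong (r ℕ.*_)
                 (trans (𝟙-∧ (allInV p 0 (+ 0) w) _) (cong (a ℕ.*_) (𝟙-∧ (C w) _))))
    distrib : ∀ r a x y h → r ℕ.* (a ℕ.* ((x ℕ.+ y) ℕ.* h)) ≡ r ℕ.* (a ℕ.* (x ℕ.* h)) ℕ.+ r ℕ.* (a ℕ.* (y ℕ.* h))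
    distrib = ℕ-Solver.solve-∀

  walkSeries-split : ∀ C C₁ C₂ → (∀ w → 𝟙 (C w) ≡ 𝟙 (C₁ w) ℕ.+ 𝟙 (C₂ w)) →
    ∀ e v i j → walkSeries C e v i j ≡ walkSeries C₁ e v i j + walkSeries C₂ e v i j
  walkSeries-split C C₁ C₂ split e v i j =
    cong +_ (count-+ (e ℕ.+ v) (λ w → walksWith-split C C₁ C₂ e i j w (split w)))

  walksWith-reject : ∀ C e i j w → C w ≡ false → walksWith C e i j w ≡ false
  walksWith-reject C e i j w C≡false rewrite C≡false =
    trans (cong (noReversal w ∧_) (∧-zeroʳ (allInV p 0 (+ 0) w))) (∧-zeroʳ (noReversal w))

  walksWith-∷ʳ : ∀ C e i j w t → walksWith C e i j (w ∷ʳ t) ≡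
    (noReversal w ∧ not (endsWith (clashes t) w)) ∧
    (allInV p 0 (+ 0) w ∧ inV p (step t (endpoint 0 (+ 0) w))) ∧ C (w ∷ʳ t) ∧ hasWeight p e i j (w ∷ʳ t)
  walksWith-∷ʳ C e i j w t = cong₂ (λ r a → r ∧ a ∧ C (w ∷ʳ t) ∧ hasWeight p e i j (w ∷ʳ t))
                                   (noReversal-∷ʳ w t) (allInV-∷ʳ 0 (+ 0) w t)

  walksWith-∷ʳE : ∀ e i j w →
    walksWith emptyOrEndsEast (suc e) i j (w ∷ʳ E) ≡ walksWith (λ _ → true) e (i - + p) (j - + p) w
  walksWith-∷ʳE e i j w
    rewrite walksWith-∷ʳ emptyOrEndsEast (suc e) i j w E | endsWith-false w
          | emptyOrEndsEast-∷ʳ w E | hasWeight-∷ʳE e i j w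
    = cong₂ _∧_ (∧-identityʳ (noReversal w)) (∧-absorbs (allInV p 0 (+ 0) w) _ _ eastInV)
    where
    eastInV : T (allInV p 0 (+ 0) w) → T (hasWeight p e (i - + p) (j - + p) w) →
              T (inV p (step E (endpoint 0 (+ 0) w)))
    eastInV a _ = InV⇒inV (step E end) (InV-E end (allInV⇒InV-endpoint 0 (+ 0) w a))
      where end = endpoint 0 (+ 0) w

  walksWith-∷ʳN : ∀ e i n w →
    𝟙 (walksWith (endsWith (_== N)) e i (+ n) (w ∷ʳ N)) ≡
    𝟙 (walksWith emptyOrEndsEast e (i - + 1) (+ n + + 1) w) ℕ.+
    𝟙 (walksWith (endsWith (_== N)) e (i - + 1) (+ n + + 1) w)
  walksWith-∷ʳN e i n w = trans (cong 𝟙 notSouth)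
    (walksWith-split (λ w → not (endsWith (_== S) w)) emptyOrEndsEast (endsWith (_== N))
                     e (i - + 1) (+ n + + 1) w (𝟙-not-endsSouth w))
    where
    end : ℕ × ℤ
    end = endpoint 0 (+ 0) w
    northInV : T (allInV p 0 (+ 0) w) → T (hasWeight p e (i - + 1) (+ n + + 1) w) → T (inV p (step N end))
    northInV a hw = InV⇒inV (step N end) (InV-N end (allInV⇒InV-endpoint 0 (+ 0) w a)
      (subst (+ 1 ℤ.≤_) (proj₂ (proj₂ (hasWeight⇒ e (i - + 1) (+ n + + 1) w hw))) (ℤ.+≤+ (ℕP.m≤n+m 1 n))))
    notSouth : walksWith (endsWith (_== N)) e i (+ n) (w ∷ʳ N) ≡
               walksWith (λ w → not (endsWith (_== S) w)) e (i - + 1) (+ n + + 1) w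
    notSouth rewrite walksWith-∷ʳ (endsWith (_== N)) e i (+ n) w N | endsWith-∷ʳ (_== N) w N
                   | hasWeight-∷ʳN e i (+ n) w
      = trans (cong ((noReversal w ∧ not (endsWith (_== S) w)) ∧_) (∧-absorbs (allInV p 0 (+ 0) w) _ _ northInV))
              (∧-shuffle (noReversal w) (not (endsWith (_== S) w)) (allInV p 0 (+ 0) w)
                         (hasWeight p e (i - + 1) (+ n + + 1) w))

  gSer-split : ∀ e v i j → gSer p e v i j ≡ fSer p e v i j + northSeries e v i j + southSeries e v i j
  gSer-split e v i j =
    trans (walkSeries-split (λ _ → true) notSouth (endsWith (_== S)) (λ w → 𝟙-excluded-middle (endsWith (_== S) w)) e v i j)
          (cong (_+ southSeries e v i j) (walkSeries-split notSouth emptyOrEndsEast (endsWith (_== N)) 𝟙-not-endsSouth e v i j))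
    where
    notSouth : List Step → Bool
    notSouth w = not (endsWith (_== S) w)
    𝟙-excluded-middle : ∀ x → 𝟙 true ≡ 𝟙 (not x) ℕ.+ 𝟙 x
    𝟙-excluded-middle true  = refl
    𝟙-excluded-middle false = refl

  count-∷ʳ-vertical : ∀ e i j n t → isVertical t ≡ true →
    count (λ w → walksWith emptyOrEndsEast e i j (w ∷ʳ t)) n ≡ 0
  count-∷ʳ-vertical e i j n t tᵛ = count-none n (λ w _ →
    walksWith-reject emptyOrEndsEast e i j (w ∷ʳ t) (trans (emptyOrEndsEast-∷ʳ w t) (cong not tᵛ)))

  fSer-east : ∀ e v i j → fSer p (suc e) v i j ≡ gSer p e v (i - + p) (j - + p)
  fSer-east e v i j = cong +_ (begin
    count F (suc (e ℕ.+ v))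
      ≡⟨ count-∷ʳ F (e ℕ.+ v) ⟩
    count (λ w → F (w ∷ʳ E)) (e ℕ.+ v) ℕ.+ count (λ w → F (w ∷ʳ N)) (e ℕ.+ v) ℕ.+ count (λ w → F (w ∷ʳ S)) (e ℕ.+ v)
      ≡⟨ cong₂ ℕ._+_ (cong₂ ℕ._+_ (count-cong (e ℕ.+ v) (λ w _ → walksWith-∷ʳE e i j w))
                                  (count-∷ʳ-vertical (suc e) i j (e ℕ.+ v) N refl))
                     (count-∷ʳ-vertical (suc e) i j (e ℕ.+ v) S refl) ⟩
    count (walksWith (λ _ → true) e (i - + p) (j - + p)) (e ℕ.+ v) ℕ.+ 0 ℕ.+ 0
      ≡⟨ trans (ℕP.+-identityʳ _) (ℕP.+-identityʳ _) ⟩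
    count (walksWith (λ _ → true) e (i - + p) (j - + p)) (e ℕ.+ v) ∎)
    where
    F : List Step → Bool
    F = walksWith emptyOrEndsEast (suc e) i j

  fSer-zero : ∀ v i j → fSer p 0 v i j ≡ one 0 v i j
  fSer-zero zero i j rewrite ℕP.*-zeroʳ p with i | j
  ... | + zero   | + zero   = refl
  ... | + zero   | + suc _  = refl
  ... | + zero   | -[1+ _ ] = refl
  ... | + suc _  | _        = refl
  ... | -[1+ _ ] | _        = refl
  fSer-zero (suc v) i j = cong +_ (begin
    count F (suc v)
      ≡⟨ count-∷ʳ F v ⟩
    count (λ w → F (w ∷ʳ E)) v ℕ.+ count (λ w → F (w ∷ʳ N)) v ℕ.+ count (λ w → F (w ∷ʳ S)) v
      ≡⟨ cong₂ ℕ._+_ (cong₂ ℕ._+_ (count-none v (λ w _ → ¬T⇒≡false (eastless w)))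
                                  (count-∷ʳ-vertical 0 i j v N refl))
                     (count-∷ʳ-vertical 0 i j v S refl) ⟩
    0 ∎)
    where
    F : List Step → Bool
    F = walksWith emptyOrEndsEast 0 i j
    eastless : ∀ w → ¬ T (F (w ∷ʳ E))
    eastless w h with trans (sym (numEast-∷ʳE w)) (proj₁ (proj₂ (proj₂ (walksWith⇒ emptyOrEndsEast 0 i j (w ∷ʳ E) h))))
    ... | ()

  northSeries-zero : ∀ e i j → northSeries e 0 i j ≡ + 0
  northSeries-zero e i j = cong +_ (count-none (e ℕ.+ 0) (λ w len → ¬T⇒≡false (tooFewSteps w len)))
    where
    tooFewSteps : ∀ w → length w ≡ e ℕ.+ 0 → ¬ T (walksWith (endsWith (_== N)) e i j w)
    tooFewSteps w len h =
      let (north , _ , k≡e , _) = walksWith⇒ (endsWith (_== N)) e i j w h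
      in ℕP.<-irrefl refl (subst₂ ℕ._<_ k≡e (trans len (ℕP.+-identityʳ e)) (numEast<length w north))

  northSeries-suc : ∀ e v i n → northSeries e (suc v) i (+ n) ≡
    fSer p e v (i - + 1) (+ n + + 1) + northSeries e v (i - + 1) (+ n + + 1)
  northSeries-suc e v i n = cong +_ (begin
    count Nw (e ℕ.+ suc v)
      ≡⟨ cong (count Nw) (ℕP.+-suc e v) ⟩
    count Nw (suc (e ℕ.+ v))
      ≡⟨ count-∷ʳ Nw (e ℕ.+ v) ⟩
    count (λ w → Nw (w ∷ʳ E)) (e ℕ.+ v) ℕ.+ count (λ w → Nw (w ∷ʳ N)) (e ℕ.+ v) ℕ.+ count (λ w → Nw (w ∷ʳ S)) (e ℕ.+ v)
      ≡⟨ cong₂ ℕ._+_ (cong₂ ℕ._+_ (notNorth E refl) (count-+ (e ℕ.+ v) (walksWith-∷ʳN e i n))) (notNorth S refl) ⟩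
    0 ℕ.+ (count (walksWith emptyOrEndsEast e i′ j′) (e ℕ.+ v) ℕ.+ count (walksWith (endsWith (_== N)) e i′ j′) (e ℕ.+ v)) ℕ.+ 0
      ≡⟨ ℕP.+-identityʳ _ ⟩
    count (walksWith emptyOrEndsEast e i′ j′) (e ℕ.+ v) ℕ.+ count (walksWith (endsWith (_== N)) e i′ j′) (e ℕ.+ v) ∎)
    where
    Nw : List Step → Bool
    Nw = walksWith (endsWith (_== N)) e i (+ n)
    i′ j′ : ℤ
    i′ = i - + 1
    j′ = + n + + 1
    notNorth : ∀ t → (t == N) ≡ false → count (λ w → Nw (w ∷ʳ t)) (e ℕ.+ v) ≡ 0
    notNorth t t≢N = count-none (e ℕ.+ v) (λ w _ →
      walksWith-reject (endsWith (_== N)) e i (+ n) (w ∷ʳ t) (trans (endsWith-∷ʳ (_== N) w t) t≢N))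

  walkSeries-negative : ∀ C e v i t → walkSeries C e v i -[1+ t ] ≡ + 0
  walkSeries-negative C e v i t = cong +_ (count-none (e ℕ.+ v) (λ w _ → ¬T⇒≡false (outside w)))
    where
    outside : ∀ w → ¬ T (walksWith C e i -[1+ t ] w)
    outside w h with walksWith⇒ C e i -[1+ t ] w h
    ... | _ , (_ , b≥0) , _ , j≡b with subst (+ 0 ℤ.≤_) (sym j≡b) b≥0
    ...   | ()

  walkSeries-flip : ∀ C C′ → (∀ w → C (map flipStep w) ≡ C′ w) →
    ∀ e v i j → walkSeries C e v i j ≡ walkSeries C′ e v j i
  walkSeries-flip C C′ C-flip e v i j = cong +_ (begin
    count (walksWith C e i j) (e ℕ.+ v)                  ≡⟨ count-flip (walksWith C e i j) (e ℕ.+ v) ⟨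
    count (walksWith C e i j ∘ map flipStep) (e ℕ.+ v)   ≡⟨ count-cong (e ℕ.+ v) (λ w _ → reflected w) ⟩
    count (walksWith C′ e j i) (e ℕ.+ v)                 ∎)
    where
    reflected : ∀ w → walksWith C e i j (map flipStep w) ≡ walksWith C′ e j i w
    reflected w = cong₂ _∧_ (noReversal-flip w)
      (cong₂ _∧_ (allInV-flip 0 (+ 0) w) (cong₂ _∧_ (C-flip w) (hasWeight-flip e i j w)))

  fSer-swap : ∀ e v i j → fSer p e v i j ≡ fSer p e v j i
  fSer-swap = walkSeries-flip emptyOrEndsEast emptyOrEndsEast emptyOrEndsEast-flip

  southSeries-swap : ∀ e v i j → southSeries e v i j ≡ northSeries e v j i
  southSeries-swap = walkSeries-flip (endsWith (_== S)) (endsWith (_== N))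
    (λ w → trans (endsWith-map (_== S) flipStep w) (endsWith-cong south-flip w))
    where
    south-flip : ∀ x → (flipStep x == S) ≡ (x == N)
    south-flip E = refl
    south-flip N = refl
    south-flip S = refl

  northSeries-geo : ∀ e v i n → northSeries e v i (+ n) ≡ geo (+ 1) (- + 1) (fSer p) e v i (+ n)
  northSeries-geo e zero    i n = northSeries-zero e i (+ n)
  northSeries-geo e (suc v) i n = begin
    northSeries e (suc v) i (+ n)
      ≡⟨ northSeries-suc e v i n ⟩
    fSer p e v (i - + 1) (+ n + + 1) + northSeries e v (i - + 1) (+ n + + 1)
      ≡⟨ cong (_+_ (fSer p e v (i - + 1) (+ n + + 1))) (northSeries-geo e v (i - + 1) (n ℕ.+ 1)) ⟩
    fSer p e v (i - + 1) (+ n + + 1) + geo (+ 1) (- + 1) (fSer p) e v (i - + 1) (+ n + + 1)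
      ≡⟨ geo-suc (+ 1) (- + 1) (fSer p) e v i (+ n) ⟨
    geo (+ 1) (- + 1) (fSer p) e (suc v) i (+ n) ∎

  substB-fSer-boundary : ∀ e v i → substB (fSer p) e v i (+ 0) ≡ fSer p e v i (+ 0) + northSeries e v i (+ 0)
  substB-fSer-boundary e v i = begin
    sumFrom 0 v (λ t → fSer p e (v ℕ.∸ t) (i - + t) (+ t))
      ≡⟨ sumFrom-0 v _ ⟩
    fSer p e v (i - + 0) (+ 0) + sumFrom 1 v (λ t → fSer p e (v ℕ.∸ t) (i - + t) (+ t))
      ≡⟨ cong₂ _+_ (cong (λ i′ → fSer p e v i′ (+ 0)) (ℤP.+-identityʳ i))
                   (sumFrom-cong 1 v (λ k → cong₂ (fSer p e (v ℕ.∸ k)) (sym (a-shift i (+ k))) (sym (b-shift (+ k))))) ⟩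
    fSer p e v i (+ 0) + geo (+ 1) (- + 1) (fSer p) e v i (+ 0)
      ≡⟨ cong (_+_ (fSer p e v i (+ 0))) (northSeries-geo e v i 0) ⟨
    fSer p e v i (+ 0) + northSeries e v i (+ 0) ∎
    where
    a-shift : ∀ i k → i - k * + 1 ≡ i - k
    a-shift = solve-∀
    b-shift : ∀ k → + 0 - k * - + 1 ≡ k
    b-shift = solve-∀

  geo-fSer-substB : ∀ e v i j → geo (+ 1) (- + 1) (fSer p ⊖ substB (fSer p)) e v i j ≡ northSeries e v i j
  geo-fSer-substB e zero    i j = sym (northSeries-zero e i j)
  geo-fSer-substB e (suc v) i j = begin
    geo (+ 1) (- + 1) δ e (suc v) i j
      ≡⟨ geo-suc (+ 1) (- + 1) δ e v i j ⟩
    δ e v (i - + 1) (j + + 1) + geo (+ 1) (- + 1) δ e v (i - + 1) (j + + 1)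
      ≡⟨ cong (_+_ (δ e v (i - + 1) (j + + 1))) (geo-fSer-substB e v (i - + 1) (j + + 1)) ⟩
    δ e v (i - + 1) (j + + 1) + northSeries e v (i - + 1) (j + + 1)
      ≡⟨ last-step j ⟩
    northSeries e (suc v) i j ∎
    where
    δ : Ser
    δ = fSer p ⊖ substB (fSer p)
    f : ℤ → ℤ
    f = fSer p e v (i - + 1)
    cancel : ∀ x y → x - (x + y) + y ≡ + 0
    cancel = solve-∀
    last-step : ∀ j → δ e v (i - + 1) (j + + 1) + northSeries e v (i - + 1) (j + + 1) ≡ northSeries e (suc v) i j
    last-step (+ n) = begin
      f (+ n + + 1) - substB (fSer p) e v (i - + 1) (+ (n ℕ.+ 1)) + northSeries e v (i - + 1) (+ n + + 1)
        ≡⟨ cong (λ m → f (+ n + + 1) - substB (fSer p) e v (i - + 1) (+ m) + northSeries e v (i - + 1) (+ n + + 1))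
                (ℕP.+-comm n 1) ⟩
      f (+ n + + 1) - + 0 + northSeries e v (i - + 1) (+ n + + 1)
        ≡⟨ cong (_+ northSeries e v (i - + 1) (+ n + + 1)) (ℤP.+-identityʳ (f (+ n + + 1))) ⟩
      f (+ n + + 1) + northSeries e v (i - + 1) (+ n + + 1)
        ≡⟨ northSeries-suc e v i n ⟨
      northSeries e (suc v) i (+ n) ∎
    last-step -[1+ zero ] = begin
      f (+ 0) - substB (fSer p) e v (i - + 1) (+ 0) + northSeries e v (i - + 1) (+ 0)
        ≡⟨ cong (λ x → f (+ 0) - x + northSeries e v (i - + 1) (+ 0)) (substB-fSer-boundary e v (i - + 1)) ⟩
      f (+ 0) - (f (+ 0) + northSeries e v (i - + 1) (+ 0)) + northSeries e v (i - + 1) (+ 0)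
        ≡⟨ cancel (f (+ 0)) (northSeries e v (i - + 1) (+ 0)) ⟩
      + 0
        ≡⟨ walkSeries-negative (endsWith (_== N)) e (suc v) i 0 ⟨
      northSeries e (suc v) i -[1+ zero ] ∎
    last-step -[1+ suc t ] = begin
      f -[1+ t ] - + 0 + northSeries e v (i - + 1) -[1+ t ]
        ≡⟨ cong₂ (λ x y → x - + 0 + y) (walkSeries-negative emptyOrEndsEast e v (i - + 1) t)
                                       (walkSeries-negative (endsWith (_== N)) e v (i - + 1) t) ⟩
      + 0
        ≡⟨ walkSeries-negative (endsWith (_== N)) e (suc v) i (suc t) ⟨
      northSeries e (suc v) i -[1+ suc t ] ∎

  substA-swap : ∀ e v i j → substA (fSer p) e v i j ≡ substB (fSer p) e v j i
  substA-swap e v (+ zero)  j = sumFrom-cong 0 v (λ t → fSer-swap e (v ℕ.∸ t) (+ t) (j - + t))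
  substA-swap e v (+ suc _) j = refl
  substA-swap e v -[1+ _ ]  j = refl

  geo-fSer-substA : ∀ e v i j → geo (- + 1) (+ 1) (fSer p ⊖ substA (fSer p)) e v i j ≡ southSeries e v i j
  geo-fSer-substA e v i j = begin
    geo (- + 1) (+ 1) (fSer p ⊖ substA (fSer p)) e v i j
      ≡⟨ geo-swap (- + 1) (+ 1) _ _ (λ e v i j → cong₂ _-_ (fSer-swap e v i j) (substA-swap e v i j)) e v i j ⟩
    geo (+ 1) (- + 1) (fSer p ⊖ substB (fSer p)) e v j i
      ≡⟨ geo-fSer-substB e v j i ⟩
    northSeries e v j i
      ≡⟨ southSeries-swap e v i j ⟨
    southSeries e v i j ∎

mainTheorem5 : (p : ℕ) → 1 ≤ p →
    (∀ e v i j → fSer p e v i j ≡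
        (one ⊕ (xab^ p · fSer p)
             ⊕ (xab^ p · geo (- + 1) (+ 1) (fSer p ⊖ substA (fSer p)))
             ⊕ (xab^ p · geo (+ 1) (- + 1) (fSer p ⊖ substB (fSer p)))) e v i j)
    × (∀ v i j → (fSer p ⊖ one) 0 v i j ≡ + 0)
    × (∀ e v i j → gSer p e v i j ≡ (fSer p ⊖ one) (suc e) v (i + + p) (j + + p))
mainTheorem5 p _ = functionalEquation , constantTerm , gSer≡fSer
  where
  functionalEquation : ∀ e v i j → fSer p e v i j ≡
    (one ⊕ (xab^ p · fSer p)
         ⊕ (xab^ p · geo (- + 1) (+ 1) (fSer p ⊖ substA (fSer p)))
         ⊕ (xab^ p · geo (+ 1) (- + 1) (fSer p ⊖ substB (fSer p)))) e v i j
  functionalEquation zero    v i j =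
    trans (fSer-zero p v i j) (sym (trans (ℤP.+-identityʳ _) (trans (ℤP.+-identityʳ _) (ℤP.+-identityʳ _))))
  functionalEquation (suc e) v i j = begin
    fSer p (suc e) v i j                                  ≡⟨ fSer-east p e v i j ⟩
    gSer p e v i′ j′                                      ≡⟨ gSer-split p e v i′ j′ ⟩
    fSer p e v i′ j′ + northSeries p e v i′ j′ + southSeries p e v i′ j′
      ≡⟨ rearrange (fSer p e v i′ j′) (northSeries p e v i′ j′) (southSeries p e v i′ j′) ⟩
    + 0 + fSer p e v i′ j′ + southSeries p e v i′ j′ + northSeries p e v i′ j′
      ≡⟨ cong₂ (λ s n → + 0 + fSer p e v i′ j′ + s + n) (geo-fSer-substA p e v i′ j′) (geo-fSer-substB p e v i′ j′) ⟨
    + 0 + fSer p e v i′ j′ + geo (- + 1) (+ 1) (fSer p ⊖ substA (fSer p)) e v i′ j′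
        + geo (+ 1) (- + 1) (fSer p ⊖ substB (fSer p)) e v i′ j′ ∎
    where
    i′ j′ : ℤ
    i′ = i - + p
    j′ = j - + p
    rearrange : ∀ f n s → f + n + s ≡ + 0 + f + s + n
    rearrange = solve-∀

  constantTerm : ∀ v i j → (fSer p ⊖ one) 0 v i j ≡ + 0
  constantTerm v i j = trans (cong (_- one 0 v i j) (fSer-zero p v i j)) (ℤP.+-inverseʳ (one 0 v i j))

  gSer≡fSer : ∀ e v i j → gSer p e v i j ≡ (fSer p ⊖ one) (suc e) v (i + + p) (j + + p)
  gSer≡fSer e v i j = begin
    gSer p e v i j                                       ≡⟨ cong₂ (gSer p e v) (unshift i (+ p)) (unshift j (+ p)) ⟩
    gSer p e v (i + + p - + p) (j + + p - + p)           ≡⟨ fSer-east p e v (i + + p) (j + + p) ⟨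
    fSer p (suc e) v (i + + p) (j + + p)                 ≡⟨ ℤP.+-identityʳ _ ⟨
    fSer p (suc e) v (i + + p) (j + + p) - + 0           ∎
    where
    unshift : ∀ i q → i ≡ i + q - q
    unshift = solve-∀
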